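{- For all states $s,s'$ of the Findel execution model and every contract $c$: if $s\curvearrowright s'$ and $c\in\mathcal{C}(s)$, then $c\in\mathcal{C}(s')$, or $\mathtt{Executed}\ \mathit{id}(c)\in\mathtt{E}(s')$, or $\mathtt{Deleted}\ \mathit{id}(c)\in\mathtt{E}(s')$.
   Context: Model of the Findel language. Addresses, identifiers and times are natural numbers. Primitives: $\mathtt{Zero}$, $\mathtt{One}(cur)$, $\mathtt{Scale}(k,P)$, $\mathtt{ScaleObs}(a,P)$, $\mathtt{Give}(P)$, $\mathtt{And}(P_1,P_2)$, $\mathtt{Or}(P_1,P_2)$, $\mathtt{If}(a,P_1,P_2)$, $\mathtt{Timebound}(t_0,t_1,P)$. A contract $c$ has fields $\mathit{id}(c)$, $\mathit{dsc}(c)$, $\mathit{prim}(c)$, $\mathit{issuer}(c)$, $\mathit{owner}(c)$, proposed owner $\mathit{po}(c)$, scale $\mathit{sc}(c)$; a description $d$ has $\mathit{id}(d),\mathit{prim}(d),\mathit{sc}(d),\mathit{vfrom}(d),\mathit{vuntil}(d)$. Events are $\mathtt{Executed}\ j$, $\mathtt{Deleted}\ j$, $\mathtt{IssuedFor}\ a\ j$. $\mathrm{execute}(P,sc,I,O,B,t,\mathcal{G},cid,did,n,L)$ is a function returning either $\bot$ or a result $(B',C',n',L')$ (new balance, list of generated contracts, new fresh id, new ledger), defined by recursion on the primitive $P$. A state is $s=\langle\mathcal{C},\mathcal{D},\mathcal{B},t,\mathcal{G},i,\mathcal{L},\mathtt{E}\rangle$ with contract list $\mathcal{C}(s)$ and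 event list $\mathtt{E}(s)$. Steps $s\curvearrowright s'$: [Issue] for $d\in\mathcal{D}$ and addresses $I,O$: prepend a new contract (id $i$, description $\mathit{id}(d)$, primitive $\mathit{prim}(d)$, issuer $I$, owner $I$, proposed owner $O$, scale $\mathit{sc}(d)$), set fresh id $i+1$, prepend $\mathtt{IssuedFor}\ O\ i$. [Join] for $c\in\mathcal{C}$, address $O$, with $\mathit{po}(c)\in\{O,0\}$, $\mathit{prim}(c)$ not of the form $\mathtt{Or}(\_,\_)$, the description $d$ of $c$ with $\mathit{vfrom}(d)\le t\le\mathit{vuntil}(d)$, and $\mathrm{execute}(\mathit{prim}(c),\mathit{sc}(c),\mathit{issuer}(c),O,\mathcal{B},t,\mathcal{G},\mathit{id}(c),\mathit{dsc}(c),i,\mathcal{L})=(\mathcal{B}',\mathcal{C}',i',\mathcal{L}')$: contracts become $(\mathcal{C}\setminus\{c\})\cup\mathcal{C}'$, balance $\mathcal{B}'$, fresh id $i'$, ledger $\mathcal{L}'$, prepend $\mathtt{Executed}\ \mathit{id}(c)$. [Join Or] as Join with $\mathit{prim}(c)=\mathtt{Or}(P_1,P_2)$, executing a chosen $P\in\{P_1,P_2\}$. [Fail] under the proposed-owner and validity-time conditions, if the corresponding execution returns $\bot$: remove $c$ from $\mathcal{C}$, prepend $\mathtt{Deleted}\ \mathit{id}(c)$, all else unchanged. [Tick] time $t\mapsto t+1$, all else unchanged. -}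

module Defs where

open import Data.Nat using (ℕ; suc; _≤_)
import Data.Empty
import Data.Unit.Base
open import Data.List using (List; []; _∷_; _++_)
open import Data.List.Membership.Propositional using (_∈_)
open import Data.Maybe using (Maybe; just; nothing)
open import Data.Product using (_×_; _,_; Σ)
open import Data.Sum using (_⊎_)
open import Relation.Binary.PropositionalEquality using (_≡_; _≢_)

Address : Set
Address = ℕ

Id : Set
Id = ℕ

Time : Set
Time = ℕ

Currency : Set
Currency = ℕ

data Primitive : Set where
  Zero      : Primitive
  One       : Currency → Primitive
  Scale     : ℕ → Primitive → Primitive
  ScaleObs  : Address → Primitive → Primitive
  Give      : Primitive → Primitive
  And       : Primitive → Primitive → Primitive
  Or        : Primitive → Primitive → Primitive
  If        : Address → Primitive → Primitive → Primitive
  Timebound : Time → Time → Primitive → Primitive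

record Contract : Set where
  constructor mkContract
  field
    id     : Id
    dsc    : Id
    prim   : Primitive
    issuer : Address
    owner  : Address
    po     : Address
    sc     : ℕ
open Contract public

record Description : Set where
  constructor mkDescription
  field
    did    : Id
    dprim  : Primitive
    dsc'   : ℕ
    vfrom  : Time
    vuntil : Time
open Description public

data Event : Set where
  Executed  : Id → Event
  Deleted   : Id → Event
  IssuedFor : Address → Id → Event

IsOr : Primitive → Set
IsOr (Or _ _) = Data.Unit.Base.⊤
IsOr _        = Data.Empty.⊥

-- The execution model: the types of balances, gateways and ledgers and the
-- function execute are not spelled out in the context; they are parameters.
-- nothing plays the role of ⊥, just (B', C', n', L') the role of a result.
record ExecModel : Set₁ where
  field
    Balance : Set
    Gateway : Set
    Ledger  : Set
    execute : Primitive → ℕ → Address → Address → Balance → Time → Gateway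
              → Id → Id → Id → Ledger
              → Maybe (Balance × List Contract × Id × Ledger)
open ExecModel public

record State (M : ExecModel) : Set where
  constructor ⟨_,_,_,_,_,_,_,_⟩
  field
    𝒞 : List Contract
    𝒟 : List Description
    ℬ : Balance M
    t : Time
    𝒢 : Gateway M
    i : Id
    ℒ : Ledger M
    E : List Event
open State public

data Without (c : Contract) : List Contract → List Contract → Set where
  []   : Without c [] []
  drop : ∀ {xs ys} → Without c xs ys → Without c (c ∷ xs) ys
  keep : ∀ {x xs ys} → x ≢ c → Without c xs ys → Without c (x ∷ xs) (x ∷ ys)

ValidDesc : List Description → Time → Contract → Description → Set
ValidDesc D t c d = d ∈ D × did d ≡ dsc c × vfrom d ≤ t × t ≤ vuntil d

-- The primitive actually executed for a contract with primitive p: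
-- p itself if it is not an Or, one of its branches if it is.
data Chosen : Primitive → Primitive → Set where
  notOr : ∀ {p} → (IsOr p → Data.Empty.⊥) → Chosen p p
  left  : ∀ {p q} → Chosen (Or p q) p
  right : ∀ {p q} → Chosen (Or p q) q
 

data _↷_ {M : ExecModel} : State M → State M → Set where
  issue : ∀ {C D B t G i L E} (d : Description) (I O : Address) → d ∈ D →
    ⟨ C , D , B , t , G , i , L , E ⟩ ↷
    ⟨ mkContract i (did d) (dprim d) I I O (dsc' d) ∷ C , D , B , t , G , suc i , L , IssuedFor O i ∷ E ⟩
  join : ∀ {C D B t G i L E} (c : Contract) (O : Address) (d : Description)
    {Crest B' C' i' L'} →
    c ∈ C → (po c ≡ O ⊎ po c ≡ 0) → (IsOr (prim c) → Data.Empty.⊥) →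
    ValidDesc D t c d →
    execute M (prim c) (sc c) (issuer c) O B t G (id c) (dsc c) i L ≡ just (B' , C' , i' , L') →
    Without c C Crest →
    ⟨ C , D , B , t , G , i , L , E ⟩ ↷
    ⟨ Crest ++ C' , D , B' , t , G , i' , L' , Executed (id c) ∷ E ⟩
  joinOr : ∀ {C D B t G i L E} (c : Contract) (O : Address) (d : Description)
    (P₁ P₂ P : Primitive) {Crest B' C' i' L'} →
    c ∈ C → (po c ≡ O ⊎ po c ≡ 0) → prim c ≡ Or P₁ P₂ → (P ≡ P₁ ⊎ P ≡ P₂) →
    ValidDesc D t c d →
    execute M P (sc c) (issuer c) O B t G (id c) (dsc c) i L ≡ just (B' , C' , i' , L') →
    Without c C Crest →
    ⟨ C , D , B , t , G , i , L , E ⟩ ↷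
    ⟨ Crest ++ C' , D , B' , t , G , i' , L' , Executed (id c) ∷ E ⟩
  fail : ∀ {C D B t G i L E} (c : Contract) (O : Address) (d : Description)
    (P : Primitive) {Crest} →
    c ∈ C → (po c ≡ O ⊎ po c ≡ 0) → Chosen (prim c) P →
    ValidDesc D t c d →
    execute M P (sc c) (issuer c) O B t G (id c) (dsc c) i L ≡ nothing →
    Without c C Crest →
    ⟨ C , D , B , t , G , i , L , E ⟩ ↷
    ⟨ Crest , D , B , t , G , i , L , Deleted (id c) ∷ E ⟩
  tick : ∀ {C D B t G i L E} →
    ⟨ C , D , B , t , G , i , L , E ⟩ ↷
    ⟨ C , D , B , suc t , G , i , L , E ⟩

module Submission where

-- A contract present before a step either survives it or is the contract the
-- step acts on.  Issue prepends a contract and Tick changes nothing, so every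
-- old contract survives.  Join, Join Or and Fail remove exactly the executed
-- contract c₀ (the relation Without c₀) and record an event about id c₀;
-- all other contracts are kept (Join and Join Or append the generated
-- contracts behind the kept ones).

open import Defs
open import Data.List.Membership.Propositional using (_∈_)
open import Data.List.Membership.Propositional.Properties using (∈-++⁺ˡ)
open import Data.List.Relation.Unary.Any using (here; there)
open import Data.Sum using (_⊎_; inj₁; inj₂; map₂)
open import Relation.Binary.PropositionalEquality using (_≡_; refl)

membership-Without : ∀ {c x C R} → Without c C R → x ∈ C → x ≡ c ⊎ x ∈ R
membership-Without (drop w)   (here refl) = inj₁ refl
membership-Without (drop w)   (there x∈C) = membership-Without w x∈C
membership-Without (keep _ w) (here refl) = inj₂ (here refl)
membership-Without (keep _ w) (there x∈C) = map₂ there (membership-Without w x∈C)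

lemma1 : (M : ExecModel) (s s' : State M) (c : Contract) →
    s ↷ s' → c ∈ 𝒞 s →
    c ∈ 𝒞 s' ⊎ (Executed (id c) ∈ E s' ⊎ Deleted (id c) ∈ E s')
lemma1 M _ _ c (issue _ _ _ _) c∈C = inj₁ (there c∈C)
lemma1 M _ _ c tick            c∈C = inj₁ c∈C
lemma1 M _ _ c (join _ _ _ _ _ _ _ _ w) c∈C
  with membership-Without w c∈C
... | inj₁ refl = inj₂ (inj₁ (here refl))
... | inj₂ kept = inj₁ (∈-++⁺ˡ kept)
lemma1 M _ _ c (joinOr _ _ _ _ _ _ _ _ _ _ _ _ w) c∈C
  with membership-Without w c∈C
... | inj₁ refl = inj₂ (inj₁ (here refl))
... | inj₂ kept = inj₁ (∈-++⁺ˡ kept)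
lemma1 M _ _ c (fail _ _ _ _ _ _ _ _ _ w) c∈C
  with membership-Without w c∈C
... | inj₁ refl = inj₂ (inj₂ (here refl))
... | inj₂ kept = inj₁ kept
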